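{- A (simple, connected) graph $G$ is a double-arborescence if and only if $G$ is a treelike comparability graph that contains no induced subgraph isomorphic to the path $P_4$ on four vertices.
   Context: A graph is a comparability graph if it admits a transitive orientation (whenever $\overrightarrow{ab}$ and $\overrightarrow{bc}$ are arcs, so is $\overrightarrow{ac}$). $G$ is a treelike comparability graph if it admits a transitive orientation whose Hasse diagram (transitive reduction), viewed as an undirected graph, is a tree. A double-arborescence is a treelike comparability graph $G=(V,E)$ having a vertex $r$ adjacent to all other vertices, i.e. $V=\{r\}\cup N_G(r)$. -}

module Defs where

open import Data.Nat using (ℕ; suc; _≤_)
open import Data.Fin using (Fin; zero; suc)
open import Data.Bool using (Bool; true; false)
open import Data.List using (List; []; _∷_; _++_; length)
open import Data.List.Relation.Unary.Linked using (Linked)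
open import Data.List.Relation.Unary.Unique.Propositional using (Unique)
open import Data.Product using (Σ; _×_; ∃; ∃-syntax)
open import Data.Sum using (_⊎_)
open import Relation.Nullary using (¬_)
open import Relation.Binary.PropositionalEquality using (_≡_; _≢_)
open import Relation.Binary.Construct.Closure.ReflexiveTransitive using (Star)
open import Function.Definitions using (Injective)

record Graph (n : ℕ) : Set where
  field
    adj     : Fin n → Fin n → Bool
    sym     : ∀ u v → adj u v ≡ adj v u
    irrefl  : ∀ v → adj v v ≡ false

open Graph public

Adj : ∀ {n} → Graph n → Fin n → Fin n → Set
Adj G u v = adj G u v ≡ true

ConnectedRel : ∀ {n} → (Fin n → Fin n → Set) → Set
ConnectedRel {n} R = (u v : Fin n) → Star R u v

HasCycle : ∀ {n} → (Fin n → Fin n → Set) → Set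
HasCycle {n} R =
  Σ (Fin n) λ x → Σ (List (Fin n)) λ ys →
    Unique (x ∷ ys) × (2 ≤ length ys) × Linked R (x ∷ ys ++ x ∷ [])

IsTree : ∀ {n} → (Fin n → Fin n → Set) → Set
IsTree R = ConnectedRel R × ¬ HasCycle R

Connected : ∀ {n} → Graph n → Set
Connected G = ConnectedRel (Adj G)

record IsTransitiveOrientation {n : ℕ} (G : Graph n) (O : Fin n → Fin n → Set) : Set where
  field
    arc⇒edge  : ∀ u v → O u v → Adj G u v
    edge⇒arc  : ∀ u v → Adj G u v → O u v ⊎ O v u
    antisym   : ∀ u v → O u v → ¬ O v u
    trans     : ∀ u v w → O u v → O v w → O u w

Cover : ∀ {n} → (Fin n → Fin n → Set) → Fin n → Fin n → Set
Cover {n} O u v = O u v × ¬ (Σ (Fin n) λ w → O u w × O w v)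

HasseUndirected : ∀ {n} → (Fin n → Fin n → Set) → Fin n → Fin n → Set
HasseUndirected O u v = Cover O u v ⊎ Cover O v u

TreelikeComparability : ∀ {n} → Graph n → Set₁
TreelikeComparability {n} G =
  Σ (Fin n → Fin n → Set) λ O →
    IsTransitiveOrientation G O × IsTree (HasseUndirected O)

DoubleArborescence : ∀ {n} → Graph n → Set₁
DoubleArborescence {n} G =
  TreelikeComparability G × (Σ (Fin n) λ r → ∀ v → v ≢ r → Adj G r v)

p4adj : Fin 4 → Fin 4 → Bool
p4adj zero (suc zero) = true
p4adj (suc zero) zero = true
p4adj (suc zero) (suc (suc zero)) = true
p4adj (suc (suc zero)) (suc zero) = true
p4adj (suc (suc zero)) (suc (suc (suc zero))) = true
p4adj (suc (suc (suc zero))) (suc (suc zero)) = true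
p4adj _ _ = false

HasInducedP4 : ∀ {n} → Graph n → Set
HasInducedP4 {n} G =
  Σ (Fin 4 → Fin n) λ f →
    Injective _≡_ _≡_ f × (∀ i j → adj G (f i) (f j) ≡ p4adj i j)

{-# OPTIONS --safe #-}
module Submission where

open import Defs
open import Level using (0ℓ)
open import Data.Nat as ℕ using (ℕ; suc; _+_; z≤n; s≤s)
import Data.Nat.Properties as ℕₚ
open import Data.Fin using (Fin; zero; suc)
open import Data.Fin.Properties using (any?; all?; decFinSubset; ¬∀⟶∃¬)
  renaming (_≟_ to _≟ᶠ_)
open import Data.Fin.Induction using (spo-noetherian)
open import Data.Bool using (true)
import Data.Bool.Properties as Bool
open import Data.List using (List; []; _∷_; _++_; length)
open import Data.List.Properties using (length-++)
open import Data.List.Relation.Unary.All as All using (All; []; _∷_)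
import Data.List.Relation.Unary.All.Properties as All
open import Data.List.Relation.Unary.Linked as Linked using (Linked; [-]; _∷_)
open import Data.List.Relation.Unary.AllPairs using ([]; _∷_)
open import Data.List.Relation.Unary.Unique.Propositional using (Unique)
import Data.List.Relation.Unary.Unique.Propositional.Properties as Unique
open import Data.List.Relation.Binary.Disjoint.Propositional using (Disjoint)
open import Data.Product using (_×_; _,_; proj₂; ∃-syntax; ∃₂)
open import Data.Sum as Sum using (_⊎_; inj₁; inj₂)
open import Data.Unit using (tt)
open import Data.Empty using (⊥-elim)
open import Function using (_∘_; flip; id)
open import Function.Bundles using (_⇔_; mk⇔)
open import Function.Definitions using (Injective)
open import Induction.WellFounded using (Acc; acc)
open import Relation.Nullary using (¬_; yes; no)
open import Relation.Nullary.Decidable using (_×-dec_; _⊎-dec_; ¬?; from-yes; decidable-stable)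
open import Relation.Unary as U using (Pred; _⊆_; _⊂_; _∪_; _⊥_)
open import Relation.Unary.Properties using (⊂-trans; ⊂-irrefl)
open import Relation.Binary using (Rel; Decidable; IsStrictPartialOrder)
import Relation.Binary.Construct.Flip.EqAndOrd as Flip
import Relation.Binary.Construct.StrictToNonStrict as StrictToNonStrict
open import Relation.Binary.PropositionalEquality as ≡ using (_≡_; _≢_; refl; cong; subst)
open import Relation.Binary.Construct.Closure.ReflexiveTransitive using (Star; ε; _◅_; _◅◅_)

-- Fix a transitive orientation _<_ of G whose Hasse diagram is acyclic. Choosing extremal bounds
-- and joining them by Hasse chains turns each of two configurations into a Hasse cycle: two
-- incomparable elements with a common lower and a common upper bound, and a crown x, u < z, t
-- admitting no m with x, u ≤ m ≤ z, t.
-- (⇒) An induced P4 can be oriented as a > b < c > d. A universal vertex r is comparable to all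
-- four, and each position of r either forces one of the missing edges ac, bd, ad or gives b, d
-- (or a, c) common bounds.
-- (⇐) Let N[x] be maximal under inclusion. If x is not universal, connectivity gives an edge wu
-- leaving N[x], oriented x < w > u after possibly reversing the order. By the crown property a
-- minimal common upper bound t of x and u lies below every other one, and P4-freeness then gives
-- N[x] ⊊ N[t].

module _ {A : Set} {R : Rel A 0ℓ} where

  -- The last vertex is omitted, so a closed walk lists each vertex of its cycle once.
  vertices : ∀ {x y} → Star R x y → List A
  vertices ε = []
  vertices {x} (_ ◅ w) = x ∷ vertices w

  vertices-◅◅ : ∀ {x y z} (v : Star R x y) (w : Star R y z) →
                vertices (v ◅◅ w) ≡ vertices v ++ vertices w
  vertices-◅◅ ε w = refl
  vertices-◅◅ {x} (_ ◅ v) w = cong (x ∷_) (vertices-◅◅ v w)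

  length-vertices-◅◅ : ∀ {x y z} (v : Star R x y) (w : Star R y z) →
                       length (vertices (v ◅◅ w)) ≡ length (vertices v) + length (vertices w)
  length-vertices-◅◅ v w = ≡.trans (cong length (vertices-◅◅ v w)) (length-++ (vertices v))

  vertices-linked : ∀ {x y} (w : Star R x y) → Linked R (vertices w ++ y ∷ [])
  vertices-linked ε = [-]
  vertices-linked (r ◅ ε) = r ∷ [-]
  vertices-linked (r ◅ w@(_ ◅ _)) = r ∷ vertices-linked w

All-disjoint : ∀ {A : Set} {P Q : Pred A 0ℓ} {xs ys} →
               All P xs → All Q ys → P ⊥ Q → Disjoint xs ys
All-disjoint ps qs P⊥Q (x∈xs , x∈ys) = P⊥Q (All.lookup ps x∈xs , All.lookup qs x∈ys)

⊥-∪ : ∀ {A : Set} {P Q S : Pred A 0ℓ} → P ⊥ Q → P ⊥ S → P ⊥ (Q ∪ S)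
⊥-∪ P⊥Q P⊥S (p , inj₁ q) = P⊥Q (p , q)
⊥-∪ P⊥Q P⊥S (p , inj₂ s) = P⊥S (p , s)

record Segment {A : Set} (R : Rel A 0ℓ) (P : Pred A 0ℓ) (x y : A) : Set where
  field
    walk     : Star R x y
    nonempty : 1 ℕ.≤ length (vertices walk)
    unique   : Unique (vertices walk)
    inside   : All P (vertices walk)

open Segment

module _ {A : Set} {R : Rel A 0ℓ} where

  size : ∀ {P x y} → Segment R P x y → ℕ
  size = length ∘ vertices ∘ walk

  weaken : ∀ {P Q : Pred A 0ℓ} {x y} → P ⊆ Q → Segment R P x y → Segment R Q x y
  weaken P⊆Q s = record
    { walk     = walk s
    ; nonempty = nonempty s
    ; unique   = unique s
    ; inside   = All.map P⊆Q (inside s)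
    }

  concat : ∀ {P Q : Pred A 0ℓ} {x y z} → Segment R P x y → Segment R Q y z → P ⊥ Q →
           Segment R (P ∪ Q) x z
  concat s t P⊥Q = record
    { walk     = walk s ◅◅ walk t
    ; nonempty = subst (1 ℕ.≤_) (≡.sym (length-vertices-◅◅ (walk s) (walk t)))
                   (ℕₚ.≤-trans (nonempty s) (ℕₚ.m≤m+n _ _))
    ; unique   = subst Unique (≡.sym (vertices-◅◅ (walk s) (walk t)))
                   (Unique.++⁺ (unique s) (unique t) (All-disjoint (inside s) (inside t) P⊥Q))
    ; inside   = subst (All _) (≡.sym (vertices-◅◅ (walk s) (walk t)))
                   (All.++⁺ (All.map inj₁ (inside s)) (All.map inj₂ (inside t)))
    }

  size-concat : ∀ {P Q : Pred A 0ℓ} {x y z}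
                (s : Segment R P x y) (t : Segment R Q y z) (P⊥Q : P ⊥ Q) →
                size (concat s t P⊥Q) ≡ size s + size t
  size-concat s t _ = length-vertices-◅◅ (walk s) (walk t)

module _ {n} {R : Rel (Fin n) 0ℓ} where

  closed-walk⇒cycle : ∀ {x} (w : Star R x x) →
                      Unique (vertices w) → 3 ℕ.≤ length (vertices w) → HasCycle R
  closed-walk⇒cycle {x} w@(_ ◅ w′) distinct (s≤s long) =
    x , vertices w′ , distinct , long , vertices-linked w

  cycle-of-four-segments :
    ∀ {P₁ P₂ P₃ P₄ : Pred (Fin n) 0ℓ} {a b c d} →
    Segment R P₁ a b → Segment R P₂ b c → Segment R P₃ c d → Segment R P₄ d a →
    P₁ ⊥ P₂ → P₁ ⊥ P₃ → P₁ ⊥ P₄ → P₂ ⊥ P₃ → P₂ ⊥ P₄ → P₃ ⊥ P₄ → HasCycle R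
  cycle-of-four-segments {P₁} {P₂} {P₃} {P₄} {a} s₁ s₂ s₃ s₄ d₁₂ d₁₃ d₁₄ d₂₃ d₂₄ d₃₄ =
    closed-walk⇒cycle (walk s) (unique s) three-vertices
    where
    d₂ = ⊥-∪ {P = P₂} d₂₃ d₂₄
    d₁ = ⊥-∪ {P = P₁} d₁₂ (⊥-∪ {P = P₁} d₁₃ d₁₄)
    s₃₄ = concat s₃ s₄ d₃₄
    s₂₃₄ = concat s₂ s₃₄ d₂
    s : Segment R (P₁ ∪ P₂ ∪ P₃ ∪ P₄) a a
    s = concat s₁ s₂₃₄ d₁
    three-vertices : 3 ℕ.≤ size s
    three-vertices = begin
      3
        ≤⟨ +-mono-≤ (nonempty s₁) (+-mono-≤ (nonempty s₂) (+-mono-≤ (nonempty s₃) z≤n)) ⟩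
      size s₁ + (size s₂ + (size s₃ + size s₄))
        ≡⟨ cong (λ k → size s₁ + (size s₂ + k)) (size-concat s₃ s₄ d₃₄) ⟨
      size s₁ + (size s₂ + size s₃₄)
        ≡⟨ cong (size s₁ +_) (size-concat s₂ s₃₄ d₂) ⟨
      size s₁ + size s₂₃₄
        ≡⟨ size-concat s₁ s₂₃₄ d₁ ⟨
      size s
        ∎
      where open ℕₚ using (+-mono-≤; module ≤-Reasoning)
            open ≤-Reasoning

cover-flip : ∀ {n} {O : Rel (Fin n) 0ℓ} {u v} → Cover (flip O) u v → Cover O v u
cover-flip (v<u , no-between) = v<u , λ (w , v<w , w<u) → no-between (w , w<u , v<w)

hasse-flip : ∀ {n} {O : Rel (Fin n) 0ℓ} {u v} →
             HasseUndirected (flip O) u v → HasseUndirected O u v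
hasse-flip {O = O} = Sum.swap ∘ Sum.map (cover-flip {O = O}) (cover-flip {O = O})

HasCycle-map : ∀ {n} {R S : Rel (Fin n) 0ℓ} → (∀ {u v} → R u v → S u v) → HasCycle R → HasCycle S
HasCycle-map R⇒S (x , ys , distinct , long , linked) =
  x , ys , distinct , long , Linked.map R⇒S linked

module Extremal {n} {_<_ : Rel (Fin n) 0ℓ}
                (isSPO : IsStrictPartialOrder _≡_ _<_) (_<?_ : Decidable _<_) where

  open IsStrictPartialOrder isSPO public using () renaming (irrefl to <-irrefl; trans to <-trans)
  open IsStrictPartialOrder isSPO using (<-resp-≈; <-respʳ-≈; <-respˡ-≈)
  open StrictToNonStrict _≡_ _<_ public using (_≤_)

  <-≤-trans : ∀ {x y z} → x < y → y ≤ z → x < z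
  <-≤-trans = StrictToNonStrict.<-≤-trans _≡_ _<_ <-trans <-respʳ-≈

  ≤-<-trans : ∀ {x y z} → x ≤ y → y < z → x < z
  ≤-<-trans = StrictToNonStrict.≤-<-trans _≡_ _<_ ≡.sym <-trans <-respˡ-≈

  ≤-trans : ∀ {x y z} → x ≤ y → y ≤ z → x ≤ z
  ≤-trans = StrictToNonStrict.trans _≡_ _<_ ≡.isEquivalence <-resp-≈ <-trans

  _≤?_ : Decidable _≤_
  _≤?_ = StrictToNonStrict.decidable _≡_ _<_ _≟ᶠ_ _<?_

  maximal-above : ∀ {Q : Pred (Fin n) 0ℓ} → U.Decidable Q → ∀ {a} → Q a →
                  ∃[ m ] (a ≤ m × Q m × ∀ {e} → m < e → ¬ Q e)
  maximal-above {Q} Q? {a} = go (spo-noetherian isSPO a)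
    where
    go : ∀ {a} → Acc (flip _<_) a → Q a →
         ∃[ m ] (a ≤ m × Q m × ∀ {e} → m < e → ¬ Q e)
    go {a} (acc smaller) qa with any? (λ e → a <? e ×-dec Q? e)
    ... | no none = a , inj₂ refl , qa , λ a<e qe → none (_ , a<e , qe)
    ... | yes (e , a<e , qe) with go (smaller a<e) qe
    ...   | m , e≤m , qm , maximal = m , inj₁ (<-≤-trans a<e e≤m) , qm , maximal

module Chains {n} {_<_ : Rel (Fin n) 0ℓ}
              (isSPO : IsStrictPartialOrder _≡_ _<_) (_<?_ : Decidable _<_) where

  open Extremal isSPO _<?_ public
  private module Dual = Extremal (Flip.isStrictPartialOrder isSPO) (flip _<?_)

  dual-≤ : ∀ {x y} → Dual._≤_ x y → y ≤ x
  dual-≤ = Sum.map₂ ≡.sym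

  minimal-below : ∀ {Q : Pred (Fin n) 0ℓ} → U.Decidable Q → ∀ {a} → Q a →
                  ∃[ m ] (m ≤ a × Q m × ∀ {e} → e < m → ¬ Q e)
  minimal-below Q? qa with Dual.maximal-above Q? qa
  ... | m , a≥m , qm , minimal = m , dual-≤ a≥m , qm , minimal

  covered-below : ∀ {u v} → u < v → ∃[ y ] (Cover _<_ u y × y ≤ v)
  covered-below {u} {v} u<v with minimal-below (λ e → u <? e ×-dec e ≤? v) (u<v , inj₂ refl)
  ... | y , _ , (u<y , y≤v) , minimal =
    y , (u<y , λ (e , u<e , e<y) → minimal e<y (u<e , inj₁ (<-≤-trans e<y y≤v))) , y≤v

  hasse-chain : ∀ {S : Rel (Fin n) 0ℓ} → (∀ {a b} → Cover _<_ a b → S a b) →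
                ∀ {u v} → u < v → Segment S (λ e → u ≤ e × e < v) u v
  hasse-chain {S} cover⇒S {u} {v} = go (spo-noetherian isSPO u)
    where
    go : ∀ {u} → Acc (flip _<_) u → u < v → Segment S (λ e → u ≤ e × e < v) u v
    go {u} (acc smaller) u<v with covered-below u<v
    ... | y , u⋖y , inj₂ refl = record
      { walk     = cover⇒S u⋖y ◅ ε
      ; nonempty = s≤s z≤n
      ; unique   = [] ∷ []
      ; inside   = (inj₂ refl , u<v) ∷ []
      }
    ... | y , u⋖y@(u<y , _) , inj₁ y<v = record
      { walk     = cover⇒S u⋖y ◅ walk s
      ; nonempty = s≤s z≤n
      ; unique   = All.map (λ (y≤e , _) u≡e → <-irrefl u≡e (<-≤-trans u<y y≤e)) (inside s)
                   ∷ unique s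
      ; inside   = (inj₂ refl , u<v)
                   ∷ All.map (λ (y≤e , e<v) → inj₁ (<-≤-trans u<y y≤e) , e<v) (inside s)
      }
      where s = go (smaller u<y) y<v

module Forest {n} {_<_ : Rel (Fin n) 0ℓ}
              (isSPO : IsStrictPartialOrder _≡_ _<_) (_<?_ : Decidable _<_)
              (acyclic : ¬ HasCycle (HasseUndirected _<_)) where

  open Chains isSPO _<?_ public
  private module Dual = Chains (Flip.isStrictPartialOrder isSPO) (flip _<?_)

  ascending : ∀ {u v} → u < v → Segment (HasseUndirected _<_) (λ e → u ≤ e × e < v) u v
  ascending = hasse-chain inj₁

  descending : ∀ {u v} → u < v → Segment (HasseUndirected _<_) (λ e → e ≤ v × u < e) v u
  descending u<v = weaken (λ (v≥e , u<e) → dual-≤ v≥e , u<e)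
                          (Dual.hasse-chain (inj₂ ∘ cover-flip {O = _<_}) u<v)

  _∥_ : Rel (Fin n) 0ℓ
  a ∥ c = a ≢ c × ¬ a < c × ¬ c < a

  ∥-sym : ∀ {a c} → a ∥ c → c ∥ a
  ∥-sym (a≢c , a≮c , c≮a) = a≢c ∘ ≡.sym , c≮a , a≮c

  ∥⇒≰ : ∀ {a c} → a ∥ c → ¬ a ≤ c
  ∥⇒≰ (_ , a≮c , _) (inj₁ a<c) = a≮c a<c
  ∥⇒≰ (a≢c , _) (inj₂ a≡c) = a≢c a≡c

  bounded-pair-comparable : ∀ {a b c r} → b < a → b < c → a < r → c < r → ¬ a ∥ c
  bounded-pair-comparable {a} {b} {c} {r} b<a b<c a<r c<r a∥c@(_ , _ , c≮a)
    with maximal-above (λ e → e <? a ×-dec e <? c) (b<a , b<c)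
       | minimal-below (λ e → a <? e ×-dec c <? e) (a<r , c<r)
  ... | b′ , _ , (b′<a , b′<c) , b′-maximal | r′ , _ , (a<r′ , c<r′) , r′-minimal =
    acyclic (cycle-of-four-segments
      (ascending b′<a) (ascending a<r′) (descending c<r′) (descending b′<c)
      (λ ((_ , e<a) , (a≤e , _)) → <-irrefl refl (≤-<-trans a≤e e<a))
      (λ ((_ , e<a) , (_ , c<e)) → c≮a (<-trans c<e e<a))
      (λ { ((_ , e<a) , (inj₁ e<c , b′<e)) → b′-maximal b′<e (e<a , e<c)
         ; ((_ , c<a) , (inj₂ refl , _)) → c≮a c<a })
      (λ { ((inj₁ a<e , e<r′) , (_ , c<e)) → r′-minimal e<r′ (a<e , c<e)
         ; ((inj₂ refl , _) , (_ , c<a)) → c≮a c<a })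
      (λ ((a≤e , _) , (e≤c , _)) → ∥⇒≰ a∥c (≤-trans a≤e e≤c))
      (λ ((_ , c<e) , (e≤c , _)) → <-irrefl refl (<-≤-trans c<e e≤c)))

  Interpolant : Fin n → Fin n → Fin n → Fin n → Pred (Fin n) 0ℓ
  Interpolant x u z t m = x ≤ m × u ≤ m × m ≤ z × m ≤ t

  crown⇒cycle : ∀ {x u z t} → x < z → x < t → u < z → u < t →
                (∀ m → ¬ Interpolant x u z t m) → HasCycle (HasseUndirected _<_)
  crown⇒cycle {x} {u} {z} {t} x<z x<t u<z u<t none
    with maximal-above (λ e → e <? z ×-dec e <? t) (x<z , x<t)
       | maximal-above (λ e → e <? z ×-dec e <? t) (u<z , u<t)
  ... | x⁺ , x≤x⁺ , (x⁺<z , x⁺<t) , x⁺-maximal | u⁺ , u≤u⁺ , (u⁺<z , u⁺<t) , u⁺-maximal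
    with minimal-below (λ e → x⁺ <? e ×-dec u⁺ <? e) (x⁺<t , u⁺<t)
       | minimal-below (λ e → x⁺ <? e ×-dec u⁺ <? e) (x⁺<z , u⁺<z)
  ... | t⁻ , t⁻≤t , (x⁺<t⁻ , u⁺<t⁻) , t⁻-minimal | z⁻ , z⁻≤z , (x⁺<z⁻ , u⁺<z⁻) , z⁻-minimal =
    cycle-of-four-segments
      (ascending x⁺<t⁻) (descending u⁺<t⁻) (ascending u⁺<z⁻) (descending x⁺<z⁻)
      (λ { ((inj₁ x⁺<e , e<t⁻) , (_ , u⁺<e)) → t⁻-minimal e<t⁻ (x⁺<e , u⁺<e)
         ; ((inj₂ refl , _) , (_ , u⁺<x⁺)) →
             none′ (inj₂ refl , inj₁ u⁺<x⁺ , inj₁ x⁺<z⁻ , inj₁ x⁺<t⁻) })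
      (λ ((x⁺≤e , e<t⁻) , (u⁺≤e , e<z⁻)) → none′ (x⁺≤e , u⁺≤e , inj₁ e<z⁻ , inj₁ e<t⁻))
      (λ { ((_ , e<t⁻) , (inj₁ e<z⁻ , x⁺<e)) → x⁺-maximal x⁺<e (below-z e<z⁻ , below-t e<t⁻)
         ; ((_ , z⁻<t⁻) , (inj₂ refl , _)) →
             none′ (inj₁ x⁺<z⁻ , inj₁ u⁺<z⁻ , inj₂ refl , inj₁ z⁻<t⁻) })
      (λ { ((inj₁ e<t⁻ , u⁺<e) , (_ , e<z⁻)) → u⁺-maximal u⁺<e (below-z e<z⁻ , below-t e<t⁻)
         ; ((inj₂ refl , _) , (_ , t⁻<z⁻)) →
             none′ (inj₁ x⁺<t⁻ , inj₁ u⁺<t⁻ , inj₁ t⁻<z⁻ , inj₂ refl) })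
      (λ ((e≤t⁻ , u⁺<e) , (e≤z⁻ , x⁺<e)) → none′ (inj₁ x⁺<e , inj₁ u⁺<e , e≤z⁻ , e≤t⁻))
      (λ { ((inj₁ u⁺<e , e<z⁻) , (_ , x⁺<e)) → z⁻-minimal e<z⁻ (x⁺<e , u⁺<e)
         ; ((inj₂ refl , u⁺<z⁻) , (_ , x⁺<u⁺)) →
             none′ (inj₁ x⁺<u⁺ , inj₂ refl , inj₁ u⁺<z⁻ , inj₁ u⁺<t⁻) })
    where
    none′ : ∀ {m} → ¬ Interpolant x⁺ u⁺ z⁻ t⁻ m
    none′ (x⁺≤m , u⁺≤m , m≤z⁻ , m≤t⁻) =
      none _ (≤-trans x≤x⁺ x⁺≤m , ≤-trans u≤u⁺ u⁺≤m , ≤-trans m≤z⁻ z⁻≤z , ≤-trans m≤t⁻ t⁻≤t)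
    below-z : ∀ {e} → e < z⁻ → e < z
    below-z e<z⁻ = <-≤-trans e<z⁻ z⁻≤z
    below-t : ∀ {e} → e < t⁻ → e < t
    below-t e<t⁻ = <-≤-trans e<t⁻ t⁻≤t

  common-bounds-interpolate : ∀ {x u z t} → x < z → x < t → u < z → u < t →
                              ∃[ m ] Interpolant x u z t m
  common-bounds-interpolate {x} {u} {z} {t} x<z x<t u<z u<t
    with any? (λ m → x ≤? m ×-dec u ≤? m ×-dec m ≤? z ×-dec m ≤? t)
  ... | yes interpolant = interpolant
  ... | no none = ⊥-elim (acyclic (crown⇒cycle x<z x<t u<z u<t (λ m i → none (m , i))))

  minimal-upper-bound-is-least : ∀ {x u t z} → x ∥ u → x < t → u < t →
                                 (∀ {e} → e < t → ¬ (x < e × u < e)) → x < z → u < z → t ≤ z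
  minimal-upper-bound-is-least x∥u x<t u<t t-minimal x<z u<z
    with common-bounds-interpolate x<z x<t u<z u<t
  ... | _ , _ , _ , m≤z , inj₂ refl = m≤z
  ... | _ , inj₁ x<m , inj₁ u<m , _ , inj₁ m<t = ⊥-elim (t-minimal m<t (x<m , u<m))
  ... | _ , inj₂ refl , u≤x , _ , inj₁ _ = ⊥-elim (∥⇒≰ (∥-sym x∥u) u≤x)
  ... | _ , x≤u , inj₂ refl , _ , inj₁ _ = ⊥-elim (∥⇒≰ x∥u x≤u)

adj-sym : ∀ {n} (G : Graph n) {u v} → Adj G u v → Adj G v u
adj-sym G {u} {v} uv = ≡.trans (sym G v u) uv

adj? : ∀ {n} (G : Graph n) → Decidable (Adj G)
adj? G u v = adj G u v Bool.≟ true

N[_] : ∀ {n} → Graph n → Fin n → Pred (Fin n) 0ℓ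
N[ G ] v w = v ≡ w ⊎ Adj G v w

N? : ∀ {n} (G : Graph n) v → U.Decidable (N[ G ] v)
N? G v w = v ≟ᶠ w ⊎-dec adj? G v w

IsUniversal : ∀ {n} → Graph n → Fin n → Set
IsUniversal G r = ∀ v → v ≢ r → Adj G r v

universal-adj : ∀ {n} {G : Graph n} {r v w} →
                IsUniversal G r → ¬ Adj G v w → v ≢ w → Adj G r v
universal-adj univ ¬vw v≢w = univ _ λ { refl → ¬vw (univ _ (v≢w ∘ ≡.sym)) }

record InducedP4 {n} (G : Graph n) (a b c d : Fin n) : Set where
  field
    ab  : Adj G a b
    bc  : Adj G b c
    cd  : Adj G c d
    ¬ac : ¬ Adj G a c
    ¬bd : ¬ Adj G b d
    ¬ad : ¬ Adj G a d

  a≢c : a ≢ c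
  a≢c refl = ¬ad cd

  b≢d : b ≢ d
  b≢d refl = ¬ad ab

P4-rows-differ : ∀ i j → i ≡ j ⊎ ∃[ k ] p4adj i k ≢ p4adj j k
P4-rows-differ =
  from-yes (all? λ i → all? λ j → i ≟ᶠ j ⊎-dec any? λ k → ¬? (p4adj i k Bool.≟ p4adj j k))

P4-pattern-injective : ∀ {n} (G : Graph n) (f : Fin 4 → Fin n) →
                       (∀ i j → adj G (f i) (f j) ≡ p4adj i j) → Injective _≡_ _≡_ f
P4-pattern-injective G f table {i} {j} fi≡fj with P4-rows-differ i j
... | inj₁ i≡j = i≡j
... | inj₂ (k , rows-differ) = ⊥-elim (rows-differ (begin
  p4adj i k          ≡⟨ ≡.sym (table i k) ⟩
  adj G (f i) (f k)  ≡⟨ cong (λ v → adj G v (f k)) fi≡fj ⟩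
  adj G (f j) (f k)  ≡⟨ table j k ⟩
  p4adj j k          ∎))
  where open ≡.≡-Reasoning

induced-P4 : ∀ {n} {G : Graph n} {a b c d} → InducedP4 G a b c d → HasInducedP4 G
induced-P4 {G = G} {a} {b} {c} {d} p = f , P4-pattern-injective G f table , table
  where
  open InducedP4 p
  f : Fin 4 → Fin _
  f zero                   = a
  f (suc zero)             = b
  f (suc (suc zero))       = c
  f (suc (suc (suc zero))) = d
  table : ∀ i j → adj G (f i) (f j) ≡ p4adj i j
  table zero                   zero                     = irrefl G a
  table zero                   (suc zero)               = ab
  table zero                   (suc (suc zero))         = Bool.¬-not ¬ac
  table zero                   (suc (suc (suc zero)))   = Bool.¬-not ¬ad
  table (suc zero)             zero                     = adj-sym G ab
  table (suc zero)             (suc zero)               = irrefl G b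
  table (suc zero)             (suc (suc zero))         = bc
  table (suc zero)             (suc (suc (suc zero)))   = Bool.¬-not ¬bd
  table (suc (suc zero))       zero                     = Bool.¬-not (¬ac ∘ adj-sym G)
  table (suc (suc zero))       (suc zero)               = adj-sym G bc
  table (suc (suc zero))       (suc (suc zero))         = irrefl G c
  table (suc (suc zero))       (suc (suc (suc zero)))   = cd
  table (suc (suc (suc zero))) zero                     = Bool.¬-not (¬ad ∘ adj-sym G)
  table (suc (suc (suc zero))) (suc zero)               = Bool.¬-not (¬bd ∘ adj-sym G)
  table (suc (suc (suc zero))) (suc (suc zero))         = adj-sym G cd
  table (suc (suc (suc zero))) (suc (suc (suc zero)))   = irrefl G d

induced-P4⁻ : ∀ {n} {G : Graph n} → HasInducedP4 G →
              ∃[ a ] ∃[ b ] ∃[ c ] ∃[ d ] InducedP4 G a b c d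
induced-P4⁻ (f , _ , table) =
  f zero , f (suc zero) , f (suc (suc zero)) , f (suc (suc (suc zero))) , record
  { ab  = table zero (suc zero)
  ; bc  = table (suc zero) (suc (suc zero))
  ; cd  = table (suc (suc zero)) (suc (suc (suc zero)))
  ; ¬ac = Bool.not-¬ (table zero (suc (suc zero)))
  ; ¬bd = Bool.not-¬ (table (suc zero) (suc (suc (suc zero))))
  ; ¬ad = Bool.not-¬ (table zero (suc (suc (suc zero))))
  }

⊂-N-isStrictPartialOrder : ∀ {n} (G : Graph n) →
                           IsStrictPartialOrder _≡_ (λ x y → N[ G ] x ⊂ N[ G ] y)
⊂-N-isStrictPartialOrder G = record
  { isEquivalence = ≡.isEquivalence
  ; irrefl        = λ { refl → ⊂-irrefl (id , id) }
  ; trans         = ⊂-trans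
  ; <-resp-≈      = ≡.resp₂ _
  }

⊂-N? : ∀ {n} (G : Graph n) → Decidable (λ x y → N[ G ] x ⊂ N[ G ] y)
⊂-N? G x y = decFinSubset (N? G x) (λ _ → N? G y _)
       ×-dec ¬? (decFinSubset (N? G y) (λ _ → N? G x _))

neighbourhood-maximal-vertex : ∀ {n} (G : Graph (suc n)) →
                               ∃[ x ] ∀ {t} → ¬ (N[ G ] x ⊂ N[ G ] t)
neighbourhood-maximal-vertex G
  with Extremal.maximal-above (⊂-N-isStrictPartialOrder G) (⊂-N? G)
         {Q = U.U} (λ _ → yes tt) {zero} tt
... | x , _ , _ , maximal = x , λ x⊂t → maximal x⊂t tt

exit-edge : ∀ {A : Set} {R : Rel A 0ℓ} {P : Pred A 0ℓ} → U.Decidable P →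
            ∀ {x y} → Star R x y → P x → ¬ P y → ∃₂ λ w u → P w × R w u × ¬ P u
exit-edge P? ε px ¬py = ⊥-elim (¬py px)
exit-edge P? (_◅_ {j = z} r w) px ¬py with P? z
... | yes pz = exit-edge P? w pz ¬py
... | no ¬pz = _ , z , px , r , ¬pz

module _ {n} {G : Graph n} {O : Rel (Fin n) 0ℓ} (T : IsTransitiveOrientation G O) where

  open IsTransitiveOrientation T

  orientation-isStrictPartialOrder : IsStrictPartialOrder _≡_ O
  orientation-isStrictPartialOrder = record
    { isEquivalence = ≡.isEquivalence
    ; irrefl        = λ { refl u<u → antisym _ _ u<u u<u }
    ; trans         = trans _ _ _
    ; <-resp-≈      = ≡.resp₂ O
    }

  orientation-decidable : Decidable O
  orientation-decidable u v with adj? G u v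
  ... | no ¬uv = no (¬uv ∘ arc⇒edge u v)
  ... | yes uv = Sum.[ yes , no ∘ antisym v u ] (edge⇒arc u v uv)

  flip-orientation : IsTransitiveOrientation G (flip O)
  flip-orientation = record
    { arc⇒edge = λ u v v<u → adj-sym G (arc⇒edge v u v<u)
    ; edge⇒arc = λ u v uv → Sum.swap (edge⇒arc u v uv)
    ; antisym  = λ u v → antisym v u
    ; trans    = λ u v w v<u w<v → trans w v u w<v v<u
    }

flip-acyclic : ∀ {n} {O : Rel (Fin n) 0ℓ} →
               ¬ HasCycle (HasseUndirected O) → ¬ HasCycle (HasseUndirected (flip O))
flip-acyclic {O = O} acyclic = acyclic ∘ HasCycle-map (hasse-flip {O = O})

module Treelike {n} {G : Graph n} {O : Rel (Fin n) 0ℓ}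
                (T : IsTransitiveOrientation G O) (acyclic : ¬ HasCycle (HasseUndirected O)) where

  open IsTransitiveOrientation T using (arc⇒edge; edge⇒arc)
  open Forest (orientation-isStrictPartialOrder T) (orientation-decidable T) acyclic

  private
    _<_ : Rel (Fin n) 0ℓ
    _<_ = O

    _<?_ : Decidable _<_
    _<?_ = orientation-decidable T

  <⇒adj : ∀ {u v} → u < v → Adj G u v
  <⇒adj = arc⇒edge _ _

  >⇒adj : ∀ {u v} → u < v → Adj G v u
  >⇒adj = adj-sym G ∘ <⇒adj

  nonadjacent⇒∥ : ∀ {u v} → u ≢ v → ¬ Adj G u v → u ∥ v
  nonadjacent⇒∥ u≢v ¬uv = u≢v , ¬uv ∘ <⇒adj , ¬uv ∘ >⇒adj

  P4-has-no-universal-vertex : ∀ {a b c d r} → b < a → InducedP4 G a b c d → ¬ IsUniversal G r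
  P4-has-no-universal-vertex {a} {b} {c} {d} {r} b<a p univ =
    cases (versus-r ¬bd b≢d) (versus-r (¬ac ∘ adj-sym G) (a≢c ∘ ≡.sym))
          (versus-r (¬bd ∘ adj-sym G) (b≢d ∘ ≡.sym)) (versus-r ¬ac a≢c)
    where
    open InducedP4 p
    b<c : b < c
    b<c with edge⇒arc b c bc
    ... | inj₁ b<c = b<c
    ... | inj₂ c<b = ⊥-elim (¬ac (>⇒adj (<-trans c<b b<a)))
    d<c : d < c
    d<c with edge⇒arc c d cd
    ... | inj₁ c<d = ⊥-elim (¬bd (<⇒adj (<-trans b<c c<d)))
    ... | inj₂ d<c = d<c
    versus-r : ∀ {v w} → ¬ Adj G v w → v ≢ w → r < v ⊎ v < r
    versus-r ¬vw v≢w = edge⇒arc r _ (universal-adj {G = G} univ ¬vw v≢w)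
    cases : r < b ⊎ b < r → r < c ⊎ c < r → r < d ⊎ d < r → ¬ (r < a ⊎ a < r)
    cases (inj₁ r<b) _          (inj₁ r<d) _          =
      bounded-pair-comparable r<b r<d b<c d<c (nonadjacent⇒∥ b≢d ¬bd)
    cases (inj₁ r<b) _          (inj₂ d<r) _          = ¬bd (>⇒adj (<-trans d<r r<b))
    cases (inj₂ b<r) _          (inj₁ r<d) _          = ¬bd (<⇒adj (<-trans b<r r<d))
    cases (inj₂ _)   (inj₁ r<c) (inj₂ d<r) (inj₁ r<a) = ¬ad (>⇒adj (<-trans d<r r<a))
    cases (inj₂ _)   (inj₁ r<c) (inj₂ _)   (inj₂ a<r) = ¬ac (<⇒adj (<-trans a<r r<c))
    cases (inj₂ _)   (inj₂ c<r) _          (inj₁ r<a) = ¬ac (>⇒adj (<-trans c<r r<a))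
    cases (inj₂ _)   (inj₂ c<r) _          (inj₂ a<r) =
      bounded-pair-comparable b<a b<c a<r c<r (nonadjacent⇒∥ a≢c ¬ac)

  closed-neighbourhood-grows : ∀ {x u w} → x < w → u < w → ¬ N[ G ] x u →
                               ¬ HasInducedP4 G → ∃[ t ] N[ G ] x ⊂ N[ G ] t
  closed-neighbourhood-grows {x} {u} x<w u<w u∉N[x] P4-free
    with minimal-below (λ e → x <? e ×-dec u <? e) (x<w , u<w)
  ... | t , _ , (x<t , u<t) , t-minimal =
    t , (λ {z} z∈N[x] → decidable-stable (N? G t z) (not-outside z∈N[x])) ,
        (λ N[t]⊆N[x] → u∉N[x] (N[t]⊆N[x] (inj₂ (>⇒adj u<t))))
    where
    ≤⇒N[t] : ∀ {z} → t ≤ z → N[ G ] t z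
    ≤⇒N[t] (inj₁ t<z) = inj₂ (<⇒adj t<z)
    ≤⇒N[t] (inj₂ t≡z) = inj₁ t≡z
    not-outside : ∀ {z} → N[ G ] x z → ¬ ¬ N[ G ] t z
    not-outside (inj₁ refl) z∉N[t] = z∉N[t] (inj₂ (>⇒adj x<t))
    not-outside {z} (inj₂ xz) z∉N[t] with edge⇒arc x z xz
    ... | inj₂ z<x = z∉N[t] (inj₂ (>⇒adj (<-trans z<x x<t)))
    ... | inj₁ x<z with adj? G z u
    ...   | no ¬zu = P4-free (induced-P4 {G = G} record
            { ab = adj-sym G xz ; bc = <⇒adj x<t ; cd = >⇒adj u<t
            ; ¬ac = z∉N[t] ∘ inj₂ ∘ adj-sym G ; ¬bd = u∉N[x] ∘ inj₂ ; ¬ad = ¬zu })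
    ...   | yes zu with edge⇒arc z u zu
    ...     | inj₁ z<u = u∉N[x] (inj₂ (<⇒adj (<-trans x<z z<u)))
    ...     | inj₂ u<z =
      z∉N[t] (≤⇒N[t] (minimal-upper-bound-is-least x∥u x<t u<t t-minimal x<z u<z))
      where x∥u = nonadjacent⇒∥ (u∉N[x] ∘ inj₁) (u∉N[x] ∘ inj₂)

module _ {n} {G : Graph n} {O : Rel (Fin n) 0ℓ}
         (T : IsTransitiveOrientation G O) (acyclic : ¬ HasCycle (HasseUndirected O)) where

  open IsTransitiveOrientation T

  universal⇒P4-free : ∀ {r} → IsUniversal G r → ¬ HasInducedP4 G
  universal⇒P4-free univ P4 with induced-P4⁻ P4
  ... | a , b , _ , _ , p with edge⇒arc a b (InducedP4.ab p)
  ...   | inj₁ a<b =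
    Treelike.P4-has-no-universal-vertex (flip-orientation T) (flip-acyclic acyclic) a<b p univ
  ...   | inj₂ b<a = Treelike.P4-has-no-universal-vertex T acyclic b<a p univ

  exit-edge⇒neighbourhood-grows : ∀ {x w u} → ¬ HasInducedP4 G →
                                  N[ G ] x w → Adj G w u → ¬ N[ G ] x u →
                                  ∃[ t ] N[ G ] x ⊂ N[ G ] t
  exit-edge⇒neighbourhood-grows P4-free (inj₁ refl) wu u∉N[x] = ⊥-elim (u∉N[x] (inj₂ wu))
  exit-edge⇒neighbourhood-grows {x} {w} {u} P4-free (inj₂ xw) wu u∉N[x]
    with edge⇒arc x w xw | edge⇒arc w u wu
  ... | inj₁ x<w | inj₁ w<u = ⊥-elim (u∉N[x] (inj₂ (arc⇒edge x u (trans x w u x<w w<u))))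
  ... | inj₂ w<x | inj₂ u<w =
    ⊥-elim (u∉N[x] (inj₂ (adj-sym G (arc⇒edge u x (trans u w x u<w w<x)))))
  ... | inj₁ x<w | inj₂ u<w = Treelike.closed-neighbourhood-grows T acyclic x<w u<w u∉N[x] P4-free
  ... | inj₂ w<x | inj₁ w<u =
    Treelike.closed-neighbourhood-grows (flip-orientation T) (flip-acyclic acyclic)
      w<x w<u u∉N[x] P4-free

P4-free⇒universal : ∀ {n} {G : Graph (suc n)} {O} → Connected G → IsTransitiveOrientation G O →
                    ¬ HasCycle (HasseUndirected O) → ¬ HasInducedP4 G → ∃[ r ] IsUniversal G r
P4-free⇒universal {G = G} connected T acyclic P4-free with neighbourhood-maximal-vertex G
... | x , maximal with all? (N? G x)
...   | yes N[x]-full = x , λ v v≢x → Sum.[ ⊥-elim ∘ v≢x ∘ ≡.sym , id ] (N[x]-full v)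
...   | no ¬full with ¬∀⟶∃¬ _ _ (N? G x) ¬full
...     | y , y∉N[x] with exit-edge (N? G x) (connected x y) (inj₁ refl) y∉N[x]
...       | w , u , w∈N[x] , wu , u∉N[x] =
  ⊥-elim (maximal (proj₂ (exit-edge⇒neighbourhood-grows T acyclic P4-free w∈N[x] wu u∉N[x])))

theorem4 : (n : ℕ) (G : Graph (suc n)) → Connected G →
    DoubleArborescence G ⇔ (TreelikeComparability G × ¬ HasInducedP4 G)
theorem4 n G connected = mk⇔
  (λ (treelike@(_ , T , _ , acyclic) , _ , universal) →
     treelike , universal⇒P4-free T acyclic universal)
  (λ (treelike@(_ , T , _ , acyclic) , P4-free) →
     treelike , P4-free⇒universal connected T acyclic P4-free)
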